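{- Let $\eta=(\eta_0,\ldots,\eta_n)$ be a partial orbit in a meet-tree which is a quasi-cycle with pseudo-period $u$. If $i,j,k\in\{0,\ldots,n\}$ satisfy $i\equiv j\pmod u$ and $k\neq i$, $k\neq j$, then $\eta_i\mathbin{\wedge}\eta_k=\eta_j\mathbin{\wedge}\eta_k$.
   Context: A meet-tree is a structure $(A,\leq,\mathbin{\wedge})$ where $\leq$ is a partial order such that each $A_{\leq a}=\{x:x\leq a\}$ is linearly ordered, any two elements have a common lower bound, and $a\mathbin{\wedge} b$ is the largest element of $A_{\leq a}\cap A_{\leq b}$. A partial orbit is a finite sequence $(\eta_0,\ldots,\eta_n)$ ($n>0$) such that $\eta_i\mapsto\eta_{i+1}$ ($i<n$) is a partial automorphism (preserves quantifier-free types in $\{\leq,\mathbin{\wedge}\}$). It is a quasi-cycle if it is not a cycle, spiral or comb; equivalently, $\eta_0$ is incomparable with $\eta_k$ for all $0<k\leq n$, and $\eta_0\mathbin{\wedge}\eta_k=\eta_k\mathbin{\wedge}\eta_{2k}$ for all $k>0$ with $2k\leq n$. Its pseudo-period is the smallest $u>0$ with $\eta_0\mathbin{\wedge}\eta_u=\max_{0<i\leq n}\eta_0\mathbin{\wedge}\eta_i$. -}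

module Defs where

open import Level using (Level; _⊔_) renaming (suc to lsuc)
open import Data.Nat using (ℕ; zero; suc; _+_; _*_; _≤_; _<_)
open import Data.Fin using (Fin; toℕ)
open import Data.Product using (Σ; ∃; ∃-syntax; _×_; _,_)
open import Data.Sum using (_⊎_)
open import Relation.Nullary using (¬_)
open import Relation.Binary.PropositionalEquality using (_≡_)

record MeetTree (a ℓ : Level) : Set (lsuc (a ⊔ ℓ)) where
  infix 4 _≤ₜ_
  infixl 7 _∧_
  field
    Carrier   : Set a
    _≤ₜ_      : Carrier → Carrier → Set ℓ
    _∧_       : Carrier → Carrier → Carrier
    ≤-refl    : ∀ x → x ≤ₜ x
    ≤-trans   : ∀ {x y z} → x ≤ₜ y → y ≤ₜ z → x ≤ₜ z
    ≤-antisym : ∀ {x y} → x ≤ₜ y → y ≤ₜ x → x ≡ y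
    downLinear : ∀ {x y a} → x ≤ₜ a → y ≤ₜ a → x ≤ₜ y ⊎ y ≤ₜ x
    commonLB  : ∀ x y → ∃[ c ] (c ≤ₜ x × c ≤ₜ y)
    ∧-lbˡ     : ∀ x y → x ∧ y ≤ₜ x
    ∧-lbʳ     : ∀ x y → x ∧ y ≤ₜ y
    ∧-glb     : ∀ {c x y} → c ≤ₜ x → c ≤ₜ y → c ≤ₜ x ∧ y

data Term (m : ℕ) : Set where
  var  : Fin m → Term m
  meet : Term m → Term m → Term m

module _ {a ℓ} (T : MeetTree a ℓ) where
  open MeetTree T

  eval : ∀ {m} → (Fin m → Carrier) → Term m → Carrier
  eval ρ (var i)    = ρ i
  eval ρ (meet t s) = eval ρ t ∧ eval ρ s

  -- The map x_i ↦ y_i (i < m) is a partial automorphism: it preserves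
  -- the quantifier-free type in {≤, ∧}, i.e. all atomic formulas.
  PartialAut : ∀ {m} → (Fin m → Carrier) → (Fin m → Carrier) → Set (a ⊔ ℓ)
  PartialAut x y = ∀ t s →
    ((eval x t ≤ₜ eval x s → eval y t ≤ₜ eval y s) ×
     (eval y t ≤ₜ eval y s → eval x t ≤ₜ eval x s)) ×
    ((eval x t ≡ eval x s → eval y t ≡ eval y s) ×
     (eval y t ≡ eval y s → eval x t ≡ eval x s))

  -- (η_0, …, η_n) (only the values η 0, …, η n matter) is a partial orbit:
  -- n > 0 and η_i ↦ η_{i+1} (i < n) is a partial automorphism.
  PartialOrbit : ℕ → (ℕ → Carrier) → Set (a ⊔ ℓ)
  PartialOrbit n η = (0 < n) ×
    PartialAut {n} (λ i → η (toℕ i)) (λ i → η (suc (toℕ i)))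

  -- Quasi-cycle (the equivalent characterization given in the paper).
  QuasiCycle : ℕ → (ℕ → Carrier) → Set (a ⊔ ℓ)
  QuasiCycle n η =
    (∀ k → 0 < k → k ≤ n → ¬ (η 0 ≤ₜ η k) × ¬ (η k ≤ₜ η 0)) ×
    (∀ k → 0 < k → k + k ≤ n → η 0 ∧ η k ≡ η k ∧ η (k + k))

  AttainsMax : ℕ → (ℕ → Carrier) → ℕ → Set ℓ
  AttainsMax n η u = ∀ i → 0 < i → i ≤ n → η 0 ∧ η i ≤ₜ η 0 ∧ η u

  PseudoPeriod : ℕ → (ℕ → Carrier) → ℕ → Set ℓ
  PseudoPeriod n η u = (0 < u) × (u ≤ n) × AttainsMax n η u ×
    (∀ v → 0 < v → v < u → ¬ AttainsMax n η v)

_≡_[mod_] : ℕ → ℕ → ℕ → Set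
i ≡ j [mod u ] = ∃[ m ] (i ≡ j + m * u ⊎ j ≡ i + m * u)

-- Write p ⋏ q for η_p ∧ η_q. The partial automorphism lets us translate
-- any inequality between such meets by t, as long as all indices stay ≤ n.
-- For k ∉ {i, i + u}, both i ⋏ k and (i + u) ⋏ k lie below i ⋏ (i + u), so
-- they are equal by the isosceles property of trees. Translating by min(i, k),
-- this reduces to four inequalities between meets with η_0, which follow from
-- the maximality and minimality of u, the quasi-cycle identity
-- 0 ⋏ u = u ⋏ 2u, and induction in steps of u. Walking along i, i + u, …, the
-- one step that would land on k is replaced by a double step, using the
-- translate q ⋏ (q + u) = (q + 2u) ⋏ (q + u) of the quasi-cycle identity.
module Submission where

open import Defs
open import Level using (Level)
open import Data.Nat using (ℕ; zero; suc; _+_; _*_; _∸_; _≤_; _<_; _≤?_)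
open import Data.Nat.Properties
  using (<-cmp; _≟_; +-suc; +-identityʳ; +-assoc; +-comm; m∸n+n≡m; m<n⇒0<n∸m; <⇒≤; ≰⇒>;
         m<m+n; m<n+m; m≤n+m; <-≤-trans; +-monoˡ-≤; m+n≤o⇒m≤o; m+n≤o⇒n≤o; <-irrefl; m≤n⇒m<n∨m≡n)
  renaming (≤-trans to ≤ℕ-trans)
open import Data.Nat.Induction using (<-rec)
open import Data.Fin using (fromℕ<)
open import Data.Fin.Properties using (toℕ-fromℕ<)
open import Data.Product using (∃-syntax; _×_; _,_; proj₁; proj₂; uncurry)
open import Data.Sum using (_⊎_; inj₁; inj₂; [_,_])
open import Function.Base using (_∘_)
open import Function.Bundles using (_⇔_; mk⇔; module Equivalence)
open Equivalence using (to; from)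
import Function.Properties.Equivalence as ⇔
open import Relation.Nullary using (¬_; yes; no; contradiction)
open import Relation.Binary using (tri<; tri≈; tri>)
open import Relation.Binary.Bundles using (Poset)
import Relation.Binary.Reasoning.PartialOrder as ≤-Reasoning
open import Relation.Binary.PropositionalEquality
  using (_≡_; _≢_; refl; sym; trans; cong; subst; isEquivalence)

module MeetTreeProperties {a ℓ} (T : MeetTree a ℓ) where
  open MeetTree T

  ≡⇒≤ : ∀ {x y} → x ≡ y → x ≤ₜ y
  ≡⇒≤ {x} refl = ≤-refl x

  poset : Poset a a ℓ
  poset = record
    { _≈_ = _≡_
    ; _≤_ = _≤ₜ_
    ; isPartialOrder = record
      { isPreorder = record { isEquivalence = isEquivalence ; reflexive = ≡⇒≤ ; trans = ≤-trans }
      ; antisym = ≤-antisym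
      }
    }

  isosceles : ∀ {x y z} → x ∧ z ≤ₜ x ∧ y → y ∧ z ≤ₜ x ∧ y → x ∧ z ≡ y ∧ z
  isosceles {x} {y} {z} x∧z≤x∧y y∧z≤x∧y = ≤-antisym
    (∧-glb (≤-trans x∧z≤x∧y (∧-lbʳ x y)) (∧-lbʳ x z))
    (∧-glb (≤-trans y∧z≤x∧y (∧-lbˡ x y)) (∧-lbʳ y z))

  ∧-comm : ∀ x y → x ∧ y ≡ y ∧ x
  ∧-comm x y = ≤-antisym (∧-glb (∧-lbʳ x y) (∧-lbˡ x y)) (∧-glb (∧-lbʳ y x) (∧-lbˡ y x))

<⇒∃+ : ∀ {m n} → m < n → ∃[ d ] 0 < d × d + m ≡ n
<⇒∃+ {m} {n} m<n = n ∸ m , m<n⇒0<n∸m m<n , m∸n+n≡m (<⇒≤ m<n)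

stride-induction : ∀ {ℓ} (P : ℕ → Set ℓ) {u} → 0 < u →
                   (∀ a → a ≤ u → P a) → (∀ a → 0 < a → P a → P (a + u)) → ∀ a → P a
stride-induction P {u} 0<u base step = <-rec P go
  where
  go : ∀ a → (∀ {b} → b < a → P b) → P a
  go a rec with a ≤? u
  ... | yes a≤u = base a a≤u
  ... | no  a≰u with <⇒∃+ (≰⇒> a≰u)
  ...   | b , 0<b , refl = step b 0<b (rec (m<m+n b 0<u))

module Progression (u : ℕ) where
  infix 4 _↝_
  data _↝_ (p : ℕ) : ℕ → Set where
    here : p ↝ p
    next : ∀ {q} → p ↝ q → p ↝ u + q

  ↝[*+] : ∀ m p → p ↝ m * u + p
  ↝[*+] zero    p = here
  ↝[*+] (suc m) p = subst (p ↝_) (sym (+-assoc u (m * u) p)) (next (↝[*+] m p))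

  ≡[mod]⇒↝ : ∀ {i j} → i ≡ j [mod u ] → j ↝ i ⊎ i ↝ j
  ≡[mod]⇒↝ {i} {j} (m , inj₁ i≡j+mu) = inj₁ (subst (j ↝_) (sym (trans i≡j+mu (+-comm j (m * u)))) (↝[*+] m j))
  ≡[mod]⇒↝ {i} {j} (m , inj₂ j≡i+mu) = inj₂ (subst (i ↝_) (sym (trans j≡i+mu (+-comm i (m * u)))) (↝[*+] m i))

module PartialOrbitProperties {a ℓ} (T : MeetTree a ℓ) {n : ℕ} (η : ℕ → MeetTree.Carrier T)
  (orbit : PartialOrbit T n η) where
  open MeetTree T
  open MeetTreeProperties T using (≡⇒≤)

  infix 7 _⋏_
  _⋏_ : ℕ → ℕ → Carrier
  p ⋏ q = η p ∧ η q

  orbit-step : ∀ {p q r s} → p < n → q < n → r < n → s < n →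
               (p ⋏ q ≤ₜ r ⋏ s) ⇔ (suc p ⋏ suc q ≤ₜ suc r ⋏ suc s)
  orbit-step p<n q<n r<n s<n
    rewrite sym (toℕ-fromℕ< p<n) | sym (toℕ-fromℕ< q<n) | sym (toℕ-fromℕ< r<n) | sym (toℕ-fromℕ< s<n)
    = uncurry mk⇔ (proj₁ (proj₂ orbit (meet (var (fromℕ< p<n)) (var (fromℕ< q<n)))
                                       (meet (var (fromℕ< r<n)) (var (fromℕ< s<n)))))

  shift : ∀ t {p q r s} → p + t ≤ n → q + t ≤ n → r + t ≤ n → s + t ≤ n →
          (p ⋏ q ≤ₜ r ⋏ s) ⇔ ((p + t) ⋏ (q + t) ≤ₜ (r + t) ⋏ (s + t))
  shift zero {p} {q} {r} {s} _ _ _ _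
    rewrite +-identityʳ p | +-identityʳ q | +-identityʳ r | +-identityʳ s = ⇔.refl
  shift (suc t) {p} {q} {r} {s} bp bq br bs
    rewrite +-suc p t | +-suc q t | +-suc r t | +-suc s t
    = ⇔.trans (orbit-step (m+n≤o⇒m≤o (suc p) bp) (m+n≤o⇒m≤o (suc q) bq) (m+n≤o⇒m≤o (suc r) br) (m+n≤o⇒m≤o (suc s) bs))
              (shift t bp bq br bs)

  shift-≡ : ∀ t {p q r s} → p + t ≤ n → q + t ≤ n → r + t ≤ n → s + t ≤ n →
            p ⋏ q ≡ r ⋏ s → (p + t) ⋏ (q + t) ≡ (r + t) ⋏ (s + t)
  shift-≡ t bp bq br bs eq =
    ≤-antisym (to (shift t bp bq br bs) (≡⇒≤ eq)) (to (shift t br bs bp bq) (≡⇒≤ (sym eq)))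

module QuasiCycleProperties {a ℓ} (T : MeetTree a ℓ) {n : ℕ} (η : ℕ → MeetTree.Carrier T) (u : ℕ)
  (orbit : PartialOrbit T n η) (quasi : QuasiCycle T n η) (pseudo : PseudoPeriod T n η u) where
  open MeetTree T
  open MeetTreeProperties T
  open PartialOrbitProperties T η orbit
  open Progression u
  open ≤-Reasoning poset

  0<u : 0 < u
  0<u = proj₁ pseudo

  u≤n : u ≤ n
  u≤n = proj₁ (proj₂ pseudo)

  0⋏b≤0⋏u : ∀ b → 0 < b → b ≤ n → 0 ⋏ b ≤ₜ 0 ⋏ u
  0⋏b≤0⋏u = proj₁ (proj₂ (proj₂ pseudo))

  0⋏u≰η : ∀ {v} → 0 < v → v < u → ¬ (0 ⋏ u ≤ₜ η v)
  0⋏u≰η {v} 0<v v<u 0⋏u≤ηv = proj₂ (proj₂ (proj₂ pseudo)) v 0<v v<u λ b 0<b b≤n → begin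
    0 ⋏ b ≤⟨ 0⋏b≤0⋏u b 0<b b≤n ⟩
    0 ⋏ u ≤⟨ ∧-glb (∧-lbˡ (η 0) (η u)) 0⋏u≤ηv ⟩
    0 ⋏ v ∎

  0⋏u≡u⋏[u+u] : u + u ≤ n → 0 ⋏ u ≡ u ⋏ (u + u)
  0⋏u≡u⋏[u+u] = proj₂ quasi u 0<u

  b⋏0≤b⋏u : ∀ {b} → 0 < b → b ≤ n → b ⋏ 0 ≤ₜ b ⋏ u
  b⋏0≤b⋏u {b} 0<b b≤n = ∧-glb (∧-lbˡ (η b) (η 0)) (begin
    b ⋏ 0 ≡⟨ ∧-comm (η b) (η 0) ⟩
    0 ⋏ b ≤⟨ 0⋏b≤0⋏u b 0<b b≤n ⟩
    0 ⋏ u ≤⟨ ∧-lbʳ (η 0) (η u) ⟩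
    η u   ∎)

  u⋏d≤0⋏u-unless : ∀ {d} → ¬ (0 ⋏ u ≤ₜ u ⋏ d) → u ⋏ d ≤ₜ 0 ⋏ u
  u⋏d≤0⋏u-unless {d} 0⋏u≰u⋏d with downLinear (∧-lbˡ (η u) (η d)) (∧-lbʳ (η 0) (η u))
  ... | inj₁ u⋏d≤0⋏u = u⋏d≤0⋏u
  ... | inj₂ 0⋏u≤u⋏d = contradiction 0⋏u≤u⋏d 0⋏u≰u⋏d

  -- Otherwise 0 ⋏ u would lie below η_e, or, after translating back by e,
  -- below η_(u-e); both contradict the minimality of u.
  u⋏[u+e]≤0⋏u : ∀ {e} → 0 < e → e < u → u + e ≤ n → u ⋏ (u + e) ≤ₜ 0 ⋏ u
  u⋏[u+e]≤0⋏u {e} 0<e e<u u+e≤n with <⇒∃+ e<u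
  ... | w , 0<w , w+e≡u = u⋏d≤0⋏u-unless 0⋏u≰u⋏d
    where
    0⋏u≰u⋏d : ¬ (0 ⋏ u ≤ₜ u ⋏ (u + e))
    0⋏u≰u⋏d 0⋏u≤u⋏d with downLinear (∧-lbʳ (η e) (η (u + e))) (∧-lbʳ (η u) (η (u + e)))
    ... | inj₂ u⋏d≤e⋏d = 0⋏u≰η 0<e e<u (≤-trans 0⋏u≤u⋏d (≤-trans u⋏d≤e⋏d (∧-lbˡ (η e) (η (u + e)))))
    ... | inj₁ e⋏d≤u⋏d = 0⋏u≰η 0<w w<u (≤-trans 0⋏u≤0⋏w (∧-lbʳ (η 0) (η w)))
      where
      e≤n : e ≤ n
      e≤n = m+n≤o⇒n≤o u u+e≤n
      w<u : w < u
      w<u = subst (w <_) w+e≡u (m<m+n w 0<e)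
      e⋏d≤e⋏[w+e] : e ⋏ (u + e) ≤ₜ e ⋏ (w + e)
      e⋏d≤e⋏[w+e] = begin
        e ⋏ (u + e) ≤⟨ ∧-glb (∧-lbˡ (η e) (η (u + e))) (≤-trans e⋏d≤u⋏d (∧-lbˡ (η u) (η (u + e)))) ⟩
        e ⋏ u       ≡⟨ cong (e ⋏_) (sym w+e≡u) ⟩
        e ⋏ (w + e) ∎
      0⋏u≤0⋏w : 0 ⋏ u ≤ₜ 0 ⋏ w
      0⋏u≤0⋏w = from (shift e e≤n u+e≤n e≤n (subst (_≤ n) (sym w+e≡u) u≤n)) e⋏d≤e⋏[w+e]

  u⋏[e+u]≤0⋏u : ∀ {e} → u ≤ e → e + u ≤ n → u ⋏ (e + u) ≤ₜ 0 ⋏ u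
  u⋏[e+u]≤0⋏u {e} u≤e e+u≤n = begin
    u ⋏ (e + u) ≤⟨ to (shift u u≤n e+u≤n u≤n u+u≤n) (0⋏b≤0⋏u e (<-≤-trans 0<u u≤e) (m+n≤o⇒m≤o e e+u≤n)) ⟩
    u ⋏ (u + u) ≡⟨ sym (0⋏u≡u⋏[u+u] u+u≤n) ⟩
    0 ⋏ u       ∎
    where
    u+u≤n : u + u ≤ n
    u+u≤n = ≤ℕ-trans (+-monoˡ-≤ u u≤e) e+u≤n

  u⋏d≤0⋏u : ∀ {d} → 0 < d → d ≤ n → d ≢ u → u ⋏ d ≤ₜ 0 ⋏ u
  u⋏d≤0⋏u {d} 0<d d≤n d≢u with <-cmp d u
  ... | tri< d<u _ _ = u⋏d≤0⋏u-unless λ 0⋏u≤u⋏d → 0⋏u≰η 0<d d<u (≤-trans 0⋏u≤u⋏d (∧-lbʳ (η u) (η d)))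
  ... | tri≈ _ d≡u _ = contradiction d≡u d≢u
  ... | tri> _ _ u<d with <⇒∃+ u<d
  ...   | e , 0<e , refl with u ≤? e
  ...     | yes u≤e = u⋏[e+u]≤0⋏u u≤e d≤n
  ...     | no  u≰e = subst (λ d → u ⋏ d ≤ₜ 0 ⋏ u) (+-comm u e)
                        (u⋏[u+e]≤0⋏u 0<e (≰⇒> u≰e) (subst (_≤ n) (+-comm e u) d≤n))

  a⋏0≤a⋏[u+a] : ∀ a → 0 < a → u + a ≤ n → a ⋏ 0 ≤ₜ a ⋏ (u + a)
  a⋏0≤a⋏[u+a] = stride-induction P 0<u base step
    where
    P : ℕ → Set ℓ
    P a = 0 < a → u + a ≤ n → a ⋏ 0 ≤ₜ a ⋏ (u + a)

    base : ∀ a → a ≤ u → P a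
    base a a≤u 0<a u+a≤n with m≤n⇒m<n∨m≡n a≤u
    ... | inj₂ refl = begin
      u ⋏ 0       ≡⟨ ∧-comm (η u) (η 0) ⟩
      0 ⋏ u       ≡⟨ 0⋏u≡u⋏[u+u] u+a≤n ⟩
      u ⋏ (u + u) ∎
    ... | inj₁ a<u with <⇒∃+ a<u
    ...   | w , 0<w , w+a≡u = begin
      a ⋏ 0       ≤⟨ b⋏0≤b⋏u 0<a a≤n ⟩
      a ⋏ u       ≡⟨ cong (a ⋏_) (sym w+a≡u) ⟩
      a ⋏ (w + a) ≤⟨ to (shift a a≤n w+a≤n a≤n u+a≤n) (0⋏b≤0⋏u w 0<w (m+n≤o⇒m≤o w w+a≤n)) ⟩
      a ⋏ (u + a) ∎
      where
      a≤n : a ≤ n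
      a≤n = m+n≤o⇒n≤o u u+a≤n
      w+a≤n : w + a ≤ n
      w+a≤n = subst (_≤ n) (sym w+a≡u) u≤n

    step : ∀ a → 0 < a → P a → P (a + u)
    step a 0<a ih 0<a+u u+[a+u]≤n = begin
      (a + u) ⋏ 0             ≤⟨ b⋏0≤b⋏u 0<a+u a+u≤n ⟩
      (a + u) ⋏ u             ≤⟨ to (shift u a+u≤n u≤n a+u≤n [u+a]+u≤n) (ih 0<a (m+n≤o⇒m≤o (u + a) [u+a]+u≤n)) ⟩
      (a + u) ⋏ (u + a + u)   ≡⟨ cong ((a + u) ⋏_) (+-assoc u a u) ⟩
      (a + u) ⋏ (u + (a + u)) ∎
      where
      a+u≤n : a + u ≤ n
      a+u≤n = m+n≤o⇒n≤o u u+[a+u]≤n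
      [u+a]+u≤n : u + a + u ≤ n
      [u+a]+u≤n = subst (_≤ n) (sym (+-assoc u a u)) u+[a+u]≤n

  [u+a]⋏0≤a⋏[u+a] : ∀ a → 0 < a → u + a ≤ n → (u + a) ⋏ 0 ≤ₜ a ⋏ (u + a)
  [u+a]⋏0≤a⋏[u+a] = stride-induction P 0<u base step
    where
    P : ℕ → Set ℓ
    P a = 0 < a → u + a ≤ n → (u + a) ⋏ 0 ≤ₜ a ⋏ (u + a)

    base : ∀ a → a ≤ u → P a
    base a a≤u 0<a u+a≤n with m≤n⇒m<n∨m≡n a≤u
    ... | inj₂ refl = begin
      (u + u) ⋏ 0 ≤⟨ b⋏0≤b⋏u (<-≤-trans 0<u (m≤n+m u u)) u+a≤n ⟩
      (u + u) ⋏ u ≡⟨ ∧-comm (η (u + u)) (η u) ⟩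
      u ⋏ (u + u) ∎
    ... | inj₁ a<u with <⇒∃+ a<u
    ...   | w , 0<w , w+a≡u = begin
      (u + a) ⋏ 0       ≤⟨ b⋏0≤b⋏u (<-≤-trans 0<a (m≤n+m a u)) u+a≤n ⟩
      (u + a) ⋏ u       ≡⟨ cong ((u + a) ⋏_) (sym w+a≡u) ⟩
      (u + a) ⋏ (w + a) ≤⟨ to (shift a u+a≤n w+a≤n a≤n u+a≤n) (u⋏d≤0⋏u 0<w (m+n≤o⇒m≤o w w+a≤n) w≢u) ⟩
      a ⋏ (u + a)       ∎
      where
      a≤n : a ≤ n
      a≤n = m+n≤o⇒n≤o u u+a≤n
      w+a≤n : w + a ≤ n
      w+a≤n = subst (_≤ n) (sym w+a≡u) u≤n
      w≢u : w ≢ u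
      w≢u w≡u = <-irrefl w≡u (subst (w <_) w+a≡u (m<m+n w 0<a))

    step : ∀ a → 0 < a → P a → P (a + u)
    step a 0<a ih 0<a+u u+[a+u]≤n = begin
      (u + (a + u)) ⋏ 0       ≤⟨ b⋏0≤b⋏u (<-≤-trans 0<a+u (m≤n+m (a + u) u)) u+[a+u]≤n ⟩
      (u + (a + u)) ⋏ u       ≡⟨ cong (_⋏ u) (sym (+-assoc u a u)) ⟩
      (u + a + u) ⋏ u         ≤⟨ to (shift u [u+a]+u≤n u≤n a+u≤n [u+a]+u≤n) (ih 0<a (m+n≤o⇒m≤o (u + a) [u+a]+u≤n)) ⟩
      (a + u) ⋏ (u + a + u)   ≡⟨ cong ((a + u) ⋏_) (+-assoc u a u) ⟩
      (a + u) ⋏ (u + (a + u)) ∎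
      where
      a+u≤n : a + u ≤ n
      a+u≤n = m+n≤o⇒n≤o u u+[a+u]≤n
      [u+a]+u≤n : u + a + u ≤ n
      [u+a]+u≤n = subst (_≤ n) (sym (+-assoc u a u)) u+[a+u]≤n

  i⋏k≡[u+i]⋏k : ∀ {i k} → u + i ≤ n → k ≤ n → k ≢ i → k ≢ u + i → i ⋏ k ≡ (u + i) ⋏ k
  i⋏k≡[u+i]⋏k {i} {k} u+i≤n k≤n k≢i k≢u+i with <-cmp k i
  ... | tri≈ _ k≡i _ = contradiction k≡i k≢i
  ... | tri> _ _ i<k with <⇒∃+ i<k
  ...   | d , 0<d , refl = isosceles
          (to (shift i i≤n k≤n i≤n u+i≤n) (0⋏b≤0⋏u d 0<d d≤n))
          (to (shift i u+i≤n k≤n i≤n u+i≤n) (u⋏d≤0⋏u 0<d d≤n (k≢u+i ∘ cong (_+ i))))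
    where
    i≤n : i ≤ n
    i≤n = m+n≤o⇒n≤o u u+i≤n
    d≤n : d ≤ n
    d≤n = m+n≤o⇒m≤o d k≤n
  i⋏k≡[u+i]⋏k {k = k} u+i≤n k≤n _ _ | tri< k<i _ _ with <⇒∃+ k<i
  ...   | a , 0<a , refl rewrite sym (+-assoc u a k) = isosceles
          (to (shift k a+k≤n k≤n a+k≤n u+i≤n) (a⋏0≤a⋏[u+a] a 0<a u+a≤n))
          (to (shift k u+i≤n k≤n a+k≤n u+i≤n) ([u+a]⋏0≤a⋏[u+a] a 0<a u+a≤n))
    where
    a+k≤n : a + k ≤ n
    a+k≤n = m+n≤o⇒n≤o u (subst (_≤ n) (+-assoc u a k) u+i≤n)
    u+a≤n : u + a ≤ n
    u+a≤n = m+n≤o⇒m≤o (u + a) u+i≤n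

  p⋏[u+p]≡[u+[u+p]]⋏[u+p] : ∀ {p} → u + (u + p) ≤ n → p ⋏ (u + p) ≡ (u + (u + p)) ⋏ (u + p)
  p⋏[u+p]≡[u+[u+p]]⋏[u+p] {p} u+[u+p]≤n = begin-equality
    p ⋏ (u + p)             ≡⟨ shift-≡ p p≤n u+p≤n u+p≤n [u+u]+p≤n (0⋏u≡u⋏[u+u] (m+n≤o⇒m≤o (u + u) [u+u]+p≤n)) ⟩
    (u + p) ⋏ (u + u + p)   ≡⟨ ∧-comm (η (u + p)) (η (u + u + p)) ⟩
    (u + u + p) ⋏ (u + p)   ≡⟨ cong (_⋏ (u + p)) (+-assoc u u p) ⟩
    (u + (u + p)) ⋏ (u + p) ∎
    where
    u+p≤n : u + p ≤ n
    u+p≤n = m+n≤o⇒n≤o u u+[u+p]≤n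
    p≤n : p ≤ n
    p≤n = m+n≤o⇒n≤o u u+p≤n
    [u+u]+p≤n : u + u + p ≤ n
    [u+u]+p≤n = subst (_≤ n) (sym (+-assoc u u p)) u+[u+p]≤n

  ⋏-invariant : ∀ {p q k} → p ↝ q → q ≤ n → k ≤ n → k ≢ p → k ≢ q → p ⋏ k ≡ q ⋏ k
  ⋏-invariant here _ _ _ _ = refl
  ⋏-invariant {k = k} (next {q} p↝q) u+q≤n k≤n k≢p k≢u+q with k ≟ q
  ... | no k≢q = trans (⋏-invariant p↝q (m+n≤o⇒n≤o u u+q≤n) k≤n k≢p k≢q) (i⋏k≡[u+i]⋏k u+q≤n k≤n k≢q k≢u+q)
  ... | yes refl with p↝q
  ...   | here = contradiction refl k≢p
  ...   | next {r} p↝r = trans (⋏-invariant p↝r r≤n k≤n k≢p u+r≢r) (p⋏[u+p]≡[u+[u+p]]⋏[u+p] u+q≤n)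
    where
    r≤n : r ≤ n
    r≤n = m+n≤o⇒n≤o u (m+n≤o⇒n≤o u u+q≤n)
    u+r≢r : u + r ≢ r
    u+r≢r eq = <-irrefl (sym eq) (m<n+m r 0<u)

proposition5p14 : ∀ {a ℓ : Level} (T : MeetTree a ℓ) (n : ℕ) (η : ℕ → MeetTree.Carrier T) (u : ℕ) →
    PartialOrbit T n η → QuasiCycle T n η → PseudoPeriod T n η u →
    ∀ i j k → i ≤ n → j ≤ n → k ≤ n → i ≡ j [mod u ] → ¬ (k ≡ i) → ¬ (k ≡ j) →
    MeetTree._∧_ T (η i) (η k) ≡ MeetTree._∧_ T (η j) (η k)
proposition5p14 T n η u orbit quasi pseudo i j k i≤n j≤n k≤n i≡j k≢i k≢j =
  [ (λ j↝i → sym (⋏-invariant j↝i i≤n k≤n k≢j k≢i))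
  , (λ i↝j → ⋏-invariant i↝j j≤n k≤n k≢i k≢j)
  ] (≡[mod]⇒↝ i≡j)
  where
  open Progression u
  open QuasiCycleProperties T η u orbit quasi pseudo
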